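{- For $n \geq 1$ and $0 \leq k \leq n$ let $D(n,k)$ be the number of even signed permutations $\pi \in S^D_n$ with $\operatorname{des}(\pi) = k$. If $n$ is even, then $D(n,j) = D(n,n-j)$ for all $0 \leq j \leq n$. If $n$ is odd, then $D(n,j) = D(n,n-j) + (-1)^j\binom{n}{j}$ for all $0 \leq j \leq n$.
   Context: A signed permutation of $[n]$ is a bijection $\pi$ of $\{\pm 1, \dots, \pm n\}$ with $\pi(-i) = -\pi(i)$, written in window notation $\pi(1)\pi(2)\cdots\pi(n)$. $S^D_n$ is the set of signed permutations with an even number of negative entries in window notation. For such $\pi$ put $w_0 = 0$ and $w_i = \pi(i)$ for $1 \leq i \leq n$; then $\operatorname{Des}(\pi) = \{i \in \{0, \dots, n-1\} : w_i > w_{i+1}\}$ and $\operatorname{des}(\pi) = |\operatorname{Des}(\pi)|$. -}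

module Defs where

open import Data.Bool using (Bool; true; false; _∧_; not; if_then_else_)
open import Data.Nat using (ℕ; zero; suc; _+_; _≡ᵇ_)
open import Data.Nat.Divisibility using (_∣_)
open import Data.Integer using (ℤ; +_; -_; ∣_∣; _≤ᵇ_)
open import Data.List using (List; []; _∷_; map; concatMap; length; filterᵇ; upTo)

-- A signed permutation of [n] is recorded by its window notation
-- π(1) π(2) ... π(n), a list of n integers.  Such a list is the window of a
-- (unique) signed permutation iff its entries are nonzero, lie in
-- {±1,...,±n}, and have pairwise distinct absolute values.

signedValues : ℕ → List ℤ
signedValues n = concatMap (λ i → (+ suc i) ∷ (- (+ suc i)) ∷ []) (upTo n)

allWords : {A : Set} → List A → ℕ → List (List A)
allWords xs zero    = [] ∷ []
allWords xs (suc m) = concatMap (λ x → map (x ∷_) (allWords xs m)) xs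

absFresh : ℤ → List ℤ → Bool
absFresh x []       = true
absFresh x (y ∷ ys) = not (∣ x ∣ ≡ᵇ ∣ y ∣) ∧ absFresh x ys

distinctAbs : List ℤ → Bool
distinctAbs []       = true
distinctAbs (x ∷ xs) = absFresh x xs ∧ distinctAbs xs

signedPerms : ℕ → List (List ℤ)
signedPerms n = filterᵇ distinctAbs (allWords (signedValues n) n)

negCount : List ℤ → ℕ
negCount []       = 0
negCount (x ∷ xs) = (if x ≤ᵇ - (+ 1) then 1 else 0) + negCount xs

isEven : ℕ → Bool
isEven zero          = true
isEven (suc zero)    = false
isEven (suc (suc m)) = isEven m

evenSignedPerms : ℕ → List (List ℤ)
evenSignedPerms n = filterᵇ (λ w → isEven (negCount w)) (signedPerms n)

desAux : ℤ → List ℤ → ℕ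
desAux p []       = 0
desAux p (x ∷ xs) = (if p ≤ᵇ x then 0 else 1) + desAux x xs

-- des π, with the convention w_0 = 0
des : List ℤ → ℕ
des w = desAux (+ 0) w

D : ℕ → ℕ → ℕ
D n k = length (filterᵇ (λ w → des w ≡ᵇ k) (evenSignedPerms n))

module Submission where

-- Negating every entry, π ↦ -π, permutes the signed permutations of [n];
-- since w_0 = 0, w_1, ..., w_n are distinct, each position is a descent of
-- exactly one of π and -π, and -π has n - neg(π) negative entries.  So D(n,j)
-- counts the signed permutations with n - j descents and neg ≡ n (mod 2):
-- this is D(n, n-j) for n even and the odd count O(n, n-j) for n odd.  In the
-- odd case we use the signed count D(n,k) - O(n,k) = (-1)^k C(n,k), proved for
-- words of any length over an alphabet ±U by splitting off the letters ±u of
-- least absolute value: words starting with u or -u reduce to shorter words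
-- (-u adding a descent and a sign), the other words containing ±u cancel in
-- pairs by flipping the sign of that letter, and the rest reduce to the
-- alphabet ±(U - u).  The resulting recursion is solved by Pascal's rule.

open import Defs
open import Data.Nat using (ℕ; _≤_; _∸_)
open import Data.Nat.Divisibility using (_∣_)
open import Data.Nat.Combinatorics using (_C_)
open import Data.Integer using (ℤ; +_; _+_; _*_; _^_; -1ℤ)
open import Data.Product using (_×_)
open import Relation.Nullary using (¬_)
open import Relation.Binary.PropositionalEquality using (_≡_)

open import Data.Bool using (Bool; true; false; _∧_; not; if_then_else_; T)
import Data.Bool.Properties as BP
open import Data.Nat as ℕ using (zero; suc; _<_; z≤n; s≤s; _≡ᵇ_)
import Data.Nat.Properties as ℕP
open import Data.Nat.Divisibility using (divides; _∣0; ∣m∣n⇒∣m+n; ∣-refl)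
open import Data.Nat.Combinatorics using (nCk+nC[k+1]≡[n+1]C[k+1]; nCk≡nC[n∸k])
open import Data.Integer as ℤ using (-_; ∣_∣; 0ℤ; 1ℤ; +0; -[1+_])
import Data.Integer.Properties as ℤP
open import Data.Integer.Solver using (module +-*-Solver)
import Algebra.Properties.CommutativeSemigroup ℤP.+-commutativeSemigroup as +-CS
import Algebra.Properties.CommutativeSemigroup ℕP.+-commutativeSemigroup as ℕ+-CS
open import Data.List using (List; []; _∷_; map; concatMap; length; filterᵇ; upTo; _++_)
open import Data.List.Properties using (length-upTo)
open import Data.List.Relation.Unary.All as All using (All; []; _∷_)
import Data.List.Relation.Unary.All.Properties as AllP
open import Data.List.Relation.Unary.AllPairs using (AllPairs; []; _∷_)
import Data.List.Relation.Unary.AllPairs.Properties as AllPairsP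
open import Data.Product using (_,_; proj₁; proj₂)
open import Data.Sum using (inj₁; inj₂)
open import Data.Empty using (⊥; ⊥-elim)
open import Data.Unit using (tt)
open import Function using (_∘_; id)
open import Relation.Binary.PropositionalEquality
  using (refl; sym; trans; cong; cong₂; subst; module ≡-Reasoning)
open ≡-Reasoning

private
  variable
    A B : Set

sumℤ : (A → ℤ) → List A → ℤ
sumℤ f []       = 0ℤ
sumℤ f (x ∷ xs) = f x + sumℤ f xs

when : Bool → ℤ → ℤ
when b x = if b then x else 0ℤ

sumℤ-++ : (f : A → ℤ) (xs ys : List A) → sumℤ f (xs ++ ys) ≡ sumℤ f xs + sumℤ f ys
sumℤ-++ f []       ys = sym (ℤP.+-identityˡ _)
sumℤ-++ f (x ∷ xs) ys =
  trans (cong (λ s → f x + s) (sumℤ-++ f xs ys)) (sym (ℤP.+-assoc (f x) _ _))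

sumℤ-concatMap : (f : B → ℤ) (g : A → List B) (xs : List A) →
  sumℤ f (concatMap g xs) ≡ sumℤ (λ x → sumℤ f (g x)) xs
sumℤ-concatMap f g []       = refl
sumℤ-concatMap f g (x ∷ xs) =
  trans (sumℤ-++ f (g x) (concatMap g xs)) (cong (λ s → sumℤ f (g x) + s) (sumℤ-concatMap f g xs))

sumℤ-map : (f : B → ℤ) (g : A → B) (xs : List A) → sumℤ f (map g xs) ≡ sumℤ (f ∘ g) xs
sumℤ-map f g []       = refl
sumℤ-map f g (x ∷ xs) = cong (λ s → f (g x) + s) (sumℤ-map f g xs)

sumℤ-cong : {f g : A → ℤ} (xs : List A) → (∀ x → f x ≡ g x) → sumℤ f xs ≡ sumℤ g xs
sumℤ-cong []       f≡g = refl
sumℤ-cong (x ∷ xs) f≡g = cong₂ _+_ (f≡g x) (sumℤ-cong xs f≡g)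

sumℤ-congᴬ : {P : A → Set} {f g : A → ℤ} {xs : List A} →
  All P xs → (∀ x → P x → f x ≡ g x) → sumℤ f xs ≡ sumℤ g xs
sumℤ-congᴬ []         f≡g = refl
sumℤ-congᴬ (px ∷ pxs) f≡g = cong₂ _+_ (f≡g _ px) (sumℤ-congᴬ pxs f≡g)

sumℤ-+ : (f g : A → ℤ) (xs : List A) → sumℤ (λ x → f x + g x) xs ≡ sumℤ f xs + sumℤ g xs
sumℤ-+ f g []       = refl
sumℤ-+ f g (x ∷ xs) =
  trans (cong (λ s → f x + g x + s) (sumℤ-+ f g xs)) (+-CS.interchange (f x) (g x) _ _)

sumℤ-neg : (f : A → ℤ) (xs : List A) → sumℤ (λ x → - f x) xs ≡ - sumℤ f xs
sumℤ-neg f []       = refl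
sumℤ-neg f (x ∷ xs) =
  trans (cong (λ s → - f x + s) (sumℤ-neg f xs)) (sym (ℤP.neg-distrib-+ (f x) _))

sumℤ-zero : (xs : List A) → sumℤ (λ _ → 0ℤ) xs ≡ 0ℤ
sumℤ-zero []       = refl
sumℤ-zero (x ∷ xs) = trans (ℤP.+-identityˡ _) (sumℤ-zero xs)

length-filterᵇ : (p : A → Bool) (xs : List A) →
  + length (filterᵇ p xs) ≡ sumℤ (λ x → when (p x) 1ℤ) xs
length-filterᵇ p []       = refl
length-filterᵇ p (x ∷ xs) with p x
... | true  = trans (ℤP.pos-+ 1 _) (cong (λ s → 1ℤ + s) (length-filterᵇ p xs))
... | false = trans (length-filterᵇ p xs) (sym (ℤP.+-identityˡ _))

sumℤ-filterᵇ : (f : A → ℤ) (p : A → Bool) (xs : List A) →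
  sumℤ f (filterᵇ p xs) ≡ sumℤ (λ x → when (p x) (f x)) xs
sumℤ-filterᵇ f p []       = refl
sumℤ-filterᵇ f p (x ∷ xs) with p x
... | true  = cong (λ s → f x + s) (sumℤ-filterᵇ f p xs)
... | false = trans (sumℤ-filterᵇ f p xs) (sym (ℤP.+-identityˡ _))

-- an integer equal to its negative is 0; used for sign-reversing involutions
self-negating⇒0 : (x : ℤ) → x ≡ - x → x ≡ 0ℤ
self-negating⇒0 +0        _  = refl
self-negating⇒0 ℤ.+[1+ n ] ()
self-negating⇒0 -[1+ n ]  ()

sumℤ-allWords-suc : (f : List A → ℤ) (xs : List A) (L : ℕ) →
  sumℤ f (allWords xs (suc L)) ≡ sumℤ (λ x → sumℤ (λ w → f (x ∷ w)) (allWords xs L)) xs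
sumℤ-allWords-suc f xs L =
  trans (sumℤ-concatMap f (λ x → map (x ∷_) (allWords xs L)) xs)
        (sumℤ-cong xs (λ x → sumℤ-map f (x ∷_) (allWords xs L)))

-- a letterwise substitution σ that permutes the alphabet (in the sense that
-- it leaves every sum over the alphabet unchanged) permutes the words
sumℤ-allWords-subst : (σ : A → A) (xs : List A) →
  (∀ (g : A → ℤ) → sumℤ g xs ≡ sumℤ (g ∘ σ) xs) →
  ∀ L (f : List A → ℤ) → sumℤ f (allWords xs L) ≡ sumℤ (f ∘ map σ) (allWords xs L)
sumℤ-allWords-subst σ xs σ-perm zero    f = refl
sumℤ-allWords-subst σ xs σ-perm (suc L) f = begin
  sumℤ f (allWords xs (suc L))
    ≡⟨ sumℤ-allWords-suc f xs L ⟩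
  sumℤ (λ x → sumℤ (λ w → f (x ∷ w)) (allWords xs L)) xs
    ≡⟨ σ-perm _ ⟩
  sumℤ (λ x → sumℤ (λ w → f (σ x ∷ w)) (allWords xs L)) xs
    ≡⟨ sumℤ-cong xs (λ x → sumℤ-allWords-subst σ xs σ-perm L (λ w → f (σ x ∷ w))) ⟩
  sumℤ (λ x → sumℤ (λ w → f (σ x ∷ map σ w)) (allWords xs L)) xs
    ≡⟨ sumℤ-allWords-suc (f ∘ map σ) xs L ⟨
  sumℤ (f ∘ map σ) (allWords xs (suc L)) ∎

sumℤ-allWords-congᴬ : {P : A → Set} {xs : List A} → All P xs → ∀ L {f g : List A → ℤ} →
  (∀ w → All P w → length w ≡ L → f w ≡ g w) → sumℤ f (allWords xs L) ≡ sumℤ g (allWords xs L)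
sumℤ-allWords-congᴬ pxs zero    f≡g = cong (_+ 0ℤ) (f≡g [] [] refl)
sumℤ-allWords-congᴬ {xs = xs} pxs (suc L) {f} {g} f≡g = begin
  sumℤ f (allWords xs (suc L))
    ≡⟨ sumℤ-allWords-suc f xs L ⟩
  sumℤ (λ x → sumℤ (λ w → f (x ∷ w)) (allWords xs L)) xs
    ≡⟨ sumℤ-congᴬ pxs (λ x px → sumℤ-allWords-congᴬ pxs L
                         (λ w pw lw → f≡g (x ∷ w) (px ∷ pw) (cong suc lw))) ⟩
  sumℤ (λ x → sumℤ (λ w → g (x ∷ w)) (allWords xs L)) xs
    ≡⟨ sumℤ-allWords-suc g xs L ⟨
  sumℤ g (allWords xs (suc L)) ∎

T⇒true : ∀ {b} → T b → b ≡ true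
T⇒true {true} _ = refl

true⇒T : ∀ {b} → b ≡ true → T b
true⇒T refl = tt

distinct-head : ∀ x xs → distinctAbs (x ∷ xs) ≡ true → absFresh x xs ≡ true
distinct-head x xs d with absFresh x xs
... | true = refl

distinct-tail : ∀ x xs → distinctAbs (x ∷ xs) ≡ true → distinctAbs xs ≡ true
distinct-tail x xs d with absFresh x xs
... | true = d

fresh-head : ∀ x y ys → absFresh x (y ∷ ys) ≡ true → (∣ x ∣ ≡ᵇ ∣ y ∣) ≡ false
fresh-head x y ys f with ∣ x ∣ ≡ᵇ ∣ y ∣
... | false = refl

fresh-tail : ∀ x y ys → absFresh x (y ∷ ys) ≡ true → absFresh x ys ≡ true
fresh-tail x y ys f with ∣ x ∣ ≡ᵇ ∣ y ∣
... | false = f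

≡ᵇ-refl : ∀ n → (n ≡ᵇ n) ≡ true
≡ᵇ-refl zero    = refl
≡ᵇ-refl (suc n) = ≡ᵇ-refl n

≡ᵇ-true⇒≡ : ∀ {m n} → (m ≡ᵇ n) ≡ true → m ≡ n
≡ᵇ-true⇒≡ {m} {n} e = ℕP.≡ᵇ⇒≡ m n (true⇒T e)

≡ᵇ-false⇒≢ : ∀ {m n} → (m ≡ᵇ n) ≡ false → m ≡ n → ⊥
≡ᵇ-false⇒≢ {m} e refl with trans (sym e) (≡ᵇ-refl m)
... | ()

<⇒≡ᵇ-false : ∀ {m n} → m < n → (m ≡ᵇ n) ≡ false
<⇒≡ᵇ-false {m} {n} m<n with m ≡ᵇ n in e
... | false = refl
... | true  = ⊥-elim (ℕP.<-irrefl (≡ᵇ-true⇒≡ e) m<n)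

≤∧≢ᵇ⇒< : ∀ {m n} → m ≤ n → (m ≡ᵇ n) ≡ false → m < n
≤∧≢ᵇ⇒< m≤n e = ℕP.≤∧≢⇒< m≤n (≡ᵇ-false⇒≢ e)

≤⇒≤ᵇ-true : ∀ {m n} → m ≤ n → (m ℕ.≤ᵇ n) ≡ true
≤⇒≤ᵇ-true m≤n = T⇒true (ℕP.≤⇒≤ᵇ m≤n)

>⇒≤ᵇ-false : ∀ {m n} → n < m → (m ℕ.≤ᵇ n) ≡ false
>⇒≤ᵇ-false {m} {n} n<m with m ℕ.≤ᵇ n in e
... | false = refl
... | true  = ⊥-elim (ℕP.<⇒≱ n<m (ℕP.≤ᵇ⇒≤ m n (true⇒T e)))

absFresh-cong : ∀ {a b} ws → ∣ a ∣ ≡ ∣ b ∣ → absFresh a ws ≡ absFresh b ws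
absFresh-cong []       e = refl
absFresh-cong {a} {b} (y ∷ ys) e =
  cong₂ (λ m f → not (m ≡ᵇ ∣ y ∣) ∧ f) e (absFresh-cong ys e)

module AbsPreserving (φ : ℤ → ℤ) (∣φ∣ : ∀ y → ∣ φ y ∣ ≡ ∣ y ∣) where

  absFresh-map : ∀ a ws → absFresh a (map φ ws) ≡ absFresh a ws
  absFresh-map a []       = refl
  absFresh-map a (y ∷ ys) =
    cong₂ (λ m f → not (∣ a ∣ ≡ᵇ m) ∧ f) (∣φ∣ y) (absFresh-map a ys)

  distinctAbs-map : ∀ ws → distinctAbs (map φ ws) ≡ distinctAbs ws
  distinctAbs-map []       = refl
  distinctAbs-map (y ∷ ys) =
    cong₂ _∧_ (trans (absFresh-cong (map φ ys) (∣φ∣ y)) (absFresh-map y ys)) (distinctAbs-map ys)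

flipAbs : ℕ → ℤ → ℤ
flipAbs v y = if v ≡ᵇ ∣ y ∣ then - y else y

∣flipAbs∣ : ∀ v y → ∣ flipAbs v y ∣ ≡ ∣ y ∣
∣flipAbs∣ v y with v ≡ᵇ ∣ y ∣
... | true  = ℤP.∣-i∣≡∣i∣ y
... | false = refl

flipAbs-other : ∀ v y → (v ≡ᵇ ∣ y ∣) ≡ false → flipAbs v y ≡ y
flipAbs-other v y e rewrite e = refl

flipAbs-fresh : ∀ v ys → absFresh (+ v) ys ≡ true → map (flipAbs v) ys ≡ ys
flipAbs-fresh v []       f = refl
flipAbs-fresh v (y ∷ ys) f =
  cong₂ _∷_ (flipAbs-other v y (fresh-head (+ v) y ys f)) (flipAbs-fresh v ys (fresh-tail (+ v) y ys f))

≤ᵇ-negˡ : ∀ a b → ∣ a ∣ < ∣ b ∣ → (- a ℤ.≤ᵇ b) ≡ (a ℤ.≤ᵇ b)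
≤ᵇ-negˡ (+ zero)  (+ m)     lt       = refl
≤ᵇ-negˡ (+ suc k) (+ m)     lt       = sym (≤⇒≤ᵇ-true (ℕP.<⇒≤ lt))
≤ᵇ-negˡ (+ zero)  -[1+ m ]  lt       = refl
≤ᵇ-negˡ (+ suc k) -[1+ m ]  (s≤s lt) = >⇒≤ᵇ-false lt
≤ᵇ-negˡ -[1+ k ]  (+ m)     lt       = ≤⇒≤ᵇ-true (ℕP.<⇒≤ lt)
≤ᵇ-negˡ -[1+ k ]  -[1+ m ]  (s≤s lt) = sym (>⇒≤ᵇ-false lt)

≤ᵇ-negʳ : ∀ a b → ∣ b ∣ < ∣ a ∣ → (a ℤ.≤ᵇ - b) ≡ (a ℤ.≤ᵇ b)
≤ᵇ-negʳ (+ k)    (+ zero)  lt       = refl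
≤ᵇ-negʳ (+ k)    (+ suc m) lt       = sym (>⇒≤ᵇ-false lt)
≤ᵇ-negʳ (+ k)    -[1+ m ]  lt       = >⇒≤ᵇ-false lt
≤ᵇ-negʳ -[1+ k ] (+ zero)  lt       = refl
≤ᵇ-negʳ -[1+ k ] (+ suc m) (s≤s lt) = ≤⇒≤ᵇ-true (ℕP.<⇒≤ lt)
≤ᵇ-negʳ -[1+ k ] -[1+ m ]  (s≤s lt) = sym (≤⇒≤ᵇ-true (ℕP.<⇒≤ lt))

flipAbs-≤ᵇ : ∀ v a b → v ≤ ∣ a ∣ → v ≤ ∣ b ∣ → (∣ a ∣ ≡ᵇ ∣ b ∣) ≡ false →
  (flipAbs v a ℤ.≤ᵇ flipAbs v b) ≡ (a ℤ.≤ᵇ b)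
flipAbs-≤ᵇ v a b v≤a v≤b a≢b with v ≡ᵇ ∣ a ∣ in ea | v ≡ᵇ ∣ b ∣ in eb
... | true  | true  = ⊥-elim (≡ᵇ-false⇒≢ {∣ a ∣} a≢b (trans (sym (≡ᵇ-true⇒≡ {v} ea)) (≡ᵇ-true⇒≡ {v} eb)))
... | true  | false = ≤ᵇ-negˡ a b (subst (_< ∣ b ∣) (≡ᵇ-true⇒≡ {v} ea) (≤∧≢ᵇ⇒< {v} v≤b eb))
... | false | true  = ≤ᵇ-negʳ a b (subst (_< ∣ a ∣) (≡ᵇ-true⇒≡ {v} eb) (≤∧≢ᵇ⇒< {v} v≤a ea))
... | false | false = refl

desAux-flipAbs : ∀ v p ws → All (λ y → v ≤ ∣ y ∣) (p ∷ ws) → distinctAbs (p ∷ ws) ≡ true →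
  desAux (flipAbs v p) (map (flipAbs v) ws) ≡ desAux p ws
desAux-flipAbs v p []       _                d = refl
desAux-flipAbs v p (y ∷ ys) (v≤p ∷ v≤y ∷ v≤ys) d =
  cong₂ ℕ._+_
    (cong (λ b → if b then 0 else 1) (flipAbs-≤ᵇ v p y v≤p v≤y (fresh-head p y ys (distinct-head p (y ∷ ys) d))))
    (desAux-flipAbs v y ys (v≤y ∷ v≤ys) (distinct-tail p (y ∷ ys) d))

signℤ : ℤ → ℤ
signℤ x = if x ℤ.≤ᵇ -1ℤ then -1ℤ else 1ℤ

sign : List ℤ → ℤ
sign []       = 1ℤ
sign (x ∷ xs) = signℤ x * sign xs

signℤ-neg : ∀ y → 1 ≤ ∣ y ∣ → signℤ (- y) ≡ - signℤ y
signℤ-neg (+ suc k) _ = refl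
signℤ-neg -[1+ k ]  _ = refl

sign-flipAbs : ∀ u ws → distinctAbs ws ≡ true → absFresh (+ suc u) ws ≡ false →
  sign (map (flipAbs (suc u)) ws) ≡ - sign ws
sign-flipAbs u (y ∷ ys) d f with suc u ≡ᵇ ∣ y ∣ in e
... | true  = begin
  signℤ (- y) * sign (map (flipAbs (suc u)) ys)
    ≡⟨ cong₂ _*_ (signℤ-neg y (subst (1 ≤_) (≡ᵇ-true⇒≡ e) (s≤s z≤n)))
                 (cong sign (flipAbs-fresh (suc u) ys ys-fresh)) ⟩
  (- signℤ y) * sign ys
    ≡⟨ ℤP.neg-distribˡ-* (signℤ y) (sign ys) ⟨
  - (signℤ y * sign ys) ∎
  where
  ys-fresh : absFresh (+ suc u) ys ≡ true
  ys-fresh = trans (absFresh-cong ys (≡ᵇ-true⇒≡ e)) (distinct-head y ys d)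
... | false =
  trans (cong (signℤ y *_) (sign-flipAbs u ys (distinct-tail y ys d) f)) (sym (ℤP.neg-distribʳ-* (signℤ y) (sign ys)))

-- Signed descent sums over words on an alphabet ±U

signedAlphabet : List ℕ → List ℤ
signedAlphabet U = concatMap (λ i → + suc i ∷ - (+ suc i) ∷ []) U

All-signedAlphabet : {R : ℤ → Set} {U : List ℕ} →
  All (λ i → R (+ suc i) × R -[1+ i ]) U → All R (signedAlphabet U)
All-signedAlphabet []                = []
All-signedAlphabet ((r⁺ , r⁻) ∷ rs) = r⁺ ∷ r⁻ ∷ All-signedAlphabet rs

AbsAtLeast : ℕ → ℤ → Set
AbsAtLeast v y = v ≤ ∣ y ∣

weight : (ℕ → Bool) → List ℤ → ℤ
weight P w = when (distinctAbs w) (when (P (des w)) (sign w))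

signedSum : List ℕ → ℕ → (ℕ → Bool) → ℤ
signedSum U L P = sumℤ (weight P) (allWords (signedAlphabet U) L)

sumℤ-allWords-avoiding : ∀ a b₁ b₂ ys → (∣ a ∣ ≡ᵇ ∣ b₁ ∣) ≡ true → (∣ a ∣ ≡ᵇ ∣ b₂ ∣) ≡ true →
  All (λ y → (∣ a ∣ ≡ᵇ ∣ y ∣) ≡ false) ys → ∀ L (f : List ℤ → ℤ) →
  sumℤ (λ w → when (absFresh a w) (f w)) (allWords (b₁ ∷ b₂ ∷ ys) L) ≡ sumℤ f (allWords ys L)
sumℤ-allWords-avoiding a b₁ b₂ ys e₁ e₂ ys≢a zero    f = refl
sumℤ-allWords-avoiding a b₁ b₂ ys e₁ e₂ ys≢a (suc L) f = begin
  sumℤ (λ w → when (absFresh a w) (f w)) (allWords (b₁ ∷ b₂ ∷ ys) (suc L))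
    ≡⟨ sumℤ-allWords-suc _ (b₁ ∷ b₂ ∷ ys) L ⟩
  headed b₁ + (headed b₂ + sumℤ headed ys)
    ≡⟨ cong₂ (λ p q → p + (q + sumℤ headed ys)) (headed-same e₁) (headed-same e₂) ⟩
  0ℤ + (0ℤ + sumℤ headed ys)
    ≡⟨ trans (ℤP.+-identityˡ _) (ℤP.+-identityˡ _) ⟩
  sumℤ headed ys
    ≡⟨ sumℤ-congᴬ ys≢a (λ y y≢a → trans (sumℤ-cong (allWords (b₁ ∷ b₂ ∷ ys) L)
                             (λ w → cong (λ c → when (not c ∧ absFresh a w) (f (y ∷ w))) y≢a))
                           (sumℤ-allWords-avoiding a b₁ b₂ ys e₁ e₂ ys≢a L (λ w → f (y ∷ w)))) ⟩
  sumℤ (λ y → sumℤ (λ w → f (y ∷ w)) (allWords ys L)) ys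
    ≡⟨ sumℤ-allWords-suc f ys L ⟨
  sumℤ f (allWords ys (suc L)) ∎
  where
  headed : ℤ → ℤ
  headed x = sumℤ (λ w → when (absFresh a (x ∷ w)) (f (x ∷ w))) (allWords (b₁ ∷ b₂ ∷ ys) L)
  headed-same : ∀ {b} → (∣ a ∣ ≡ᵇ ∣ b ∣) ≡ true → headed b ≡ 0ℤ
  headed-same {b} e = trans (sumℤ-cong (allWords (b₁ ∷ b₂ ∷ ys) L)
                               (λ w → cong (λ c → when (not c ∧ absFresh a w) (f (b ∷ w))) e))
                            (sumℤ-zero (allWords (b₁ ∷ b₂ ∷ ys) L))

desAux-start : ∀ u w → All (AbsAtLeast (suc u)) w → absFresh (+ suc u) w ≡ true →
  (desAux (+ suc u) w ≡ des w) × (desAux -[1+ u ] w ≡ des w)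
desAux-start u []       _         _ = refl , refl
desAux-start u (y ∷ ys) (u<y ∷ _) f =
  cong (ℕ._+ desAux y ys) (cong (λ b → if b then 0 else 1) (from-pos y lt)) ,
  cong (ℕ._+ desAux y ys) (cong (λ b → if b then 0 else 1) (from-neg y lt))
  where
  lt : suc u < ∣ y ∣
  lt = ≤∧≢ᵇ⇒< {suc u} u<y (fresh-head (+ suc u) y ys f)
  from-pos : ∀ y → suc u < ∣ y ∣ → (+ suc u ℤ.≤ᵇ y) ≡ (+0 ℤ.≤ᵇ y)
  from-pos (+ m)    lt = ≤⇒≤ᵇ-true (ℕP.<⇒≤ lt)
  from-pos -[1+ m ] lt = refl
  from-neg : ∀ y → suc u < ∣ y ∣ → (-[1+ u ] ℤ.≤ᵇ y) ≡ (+0 ℤ.≤ᵇ y)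
  from-neg (+ m)    lt       = refl
  from-neg -[1+ m ] (s≤s lt) = >⇒≤ᵇ-false lt

weight-∷-pos : ∀ P u w → All (AbsAtLeast (suc u)) w →
  weight P (+ suc u ∷ w) ≡ when (absFresh (+ suc u) w) (weight P w)
weight-∷-pos P u w w≥u with absFresh (+ suc u) w in e
... | false = refl
... | true rewrite proj₁ (desAux-start u w w≥u e) | ℤP.*-identityˡ (sign w) = refl

weight-∷-neg : ∀ P u w → All (AbsAtLeast (suc u)) w →
  weight P (-[1+ u ] ∷ w) ≡ when (absFresh (+ suc u) w) (- weight (P ∘ suc) w)
weight-∷-neg P u w w≥u rewrite absFresh-cong { -[1+ u ]} {+ suc u} w refl with absFresh (+ suc u) w in e
... | false = refl
... | true rewrite proj₂ (desAux-start u w w≥u e) | ℤP.-1*i≡-i (sign w) with distinctAbs w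
...   | false = refl
...   | true with P (suc (des w))
...     | true  = refl
...     | false = refl

weight-neg : ∀ P w w' → distinctAbs w' ≡ distinctAbs w → (distinctAbs w ≡ true → des w' ≡ des w) →
  (distinctAbs w ≡ true → sign w' ≡ - sign w) → weight P w' ≡ - weight P w
weight-neg P w w' same-distinct same-des opposite-sign rewrite same-distinct with distinctAbs w
... | false = refl
... | true rewrite same-des refl | opposite-sign refl with P (des w)
...   | true  = refl
...   | false = refl

-- The recursion for signedSum, splitting off the least absolute value u+1
-- of the alphabet ±(u ∷ U')
module FirstLetter (u : ℕ) (U' : List ℕ) (u<U' : All (u <_) U') where

  flip : ℤ → ℤ
  flip = flipAbs (suc u)

  open AbsPreserving flip (∣flipAbs∣ (suc u))

  alphabet : List ℤ
  alphabet = signedAlphabet (u ∷ U')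

  larger : All (λ y → AbsAtLeast (suc u) y × (suc u ≡ᵇ ∣ y ∣) ≡ false) (signedAlphabet U')
  larger = All-signedAlphabet (All.map (λ u<i → bigger u<i , bigger u<i) u<U')
    where
    bigger : ∀ {i} → u < i → suc u ≤ suc i × (u ≡ᵇ i) ≡ false
    bigger u<i = ℕP.m≤n⇒m≤1+n u<i , <⇒≡ᵇ-false u<i

  alphabet-above : All (AbsAtLeast (suc u)) alphabet
  alphabet-above = ℕP.≤-refl ∷ ℕP.≤-refl ∷ All.map proj₁ larger

  -- flip swaps the letters ±(u+1) and fixes the others
  flip-permutes : ∀ (g : ℤ → ℤ) → sumℤ g alphabet ≡ sumℤ (g ∘ flip) alphabet
  flip-permutes g rewrite ≡ᵇ-refl u = begin
    g (+ suc u) + (g -[1+ u ] + sumℤ g (signedAlphabet U'))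
      ≡⟨ +-CS.x∙yz≈y∙xz (g (+ suc u)) (g -[1+ u ]) _ ⟩
    g -[1+ u ] + (g (+ suc u) + sumℤ g (signedAlphabet U'))
      ≡⟨ cong (λ s → g -[1+ u ] + (g (+ suc u) + s))
              (sumℤ-congᴬ larger (λ y (_ , y≢) → cong g (sym (flipAbs-other (suc u) y y≢)))) ⟩
    g -[1+ u ] + (g (+ suc u) + sumℤ (g ∘ flip) (signedAlphabet U')) ∎

  avoiding : ∀ L (f : List ℤ → ℤ) →
    sumℤ (λ w → when (absFresh (+ suc u) w) (f w)) (allWords alphabet L) ≡ sumℤ f (allWords (signedAlphabet U') L)
  avoiding = sumℤ-allWords-avoiding (+ suc u) (+ suc u) -[1+ u ] (signedAlphabet U')
               (≡ᵇ-refl (suc u)) (≡ᵇ-refl (suc u)) (All.map proj₂ larger)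

  flip-reverses : ∀ P x w → AbsAtLeast (suc u) x → (suc u ≡ᵇ ∣ x ∣) ≡ false → All (AbsAtLeast (suc u)) w →
    when (not (absFresh (+ suc u) (map flip w))) (weight P (x ∷ map flip w))
      ≡ - when (not (absFresh (+ suc u) w)) (weight P (x ∷ w))
  flip-reverses P x w x≥u x≢u w≥u rewrite absFresh-map (+ suc u) w with absFresh (+ suc u) w in e
  ... | true  = refl
  ... | false = weight-neg P (x ∷ w) (x ∷ map flip w) same-distinct same-des opposite-sign
    where
    x-fixed : flip x ≡ x
    x-fixed = flipAbs-other (suc u) x x≢u
    same-distinct : distinctAbs (x ∷ map flip w) ≡ distinctAbs (x ∷ w)
    same-distinct = trans (cong (λ z → distinctAbs (z ∷ map flip w)) (sym x-fixed)) (distinctAbs-map (x ∷ w))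
    same-des : distinctAbs (x ∷ w) ≡ true → des (x ∷ map flip w) ≡ des (x ∷ w)
    same-des d = cong ((if +0 ℤ.≤ᵇ x then 0 else 1) ℕ.+_)
      (trans (cong (λ z → desAux z (map flip w)) (sym x-fixed)) (desAux-flipAbs (suc u) x w (x≥u ∷ w≥u) d))
    opposite-sign : distinctAbs (x ∷ w) ≡ true → sign (x ∷ map flip w) ≡ - sign (x ∷ w)
    opposite-sign d = trans (cong (signℤ x *_) (sign-flipAbs u w (distinct-tail x w d) e))
                            (sym (ℤP.neg-distribʳ-* (signℤ x) (sign w)))

  -- so these words cancel out in pairs
  containing-cancel : ∀ P L x → AbsAtLeast (suc u) x → (suc u ≡ᵇ ∣ x ∣) ≡ false →
    sumℤ (λ w → when (not (absFresh (+ suc u) w)) (weight P (x ∷ w))) (allWords alphabet L) ≡ 0ℤ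
  containing-cancel P L x x≥u x≢u = self-negating⇒0 _ (begin
    sumℤ containing (allWords alphabet L)
      ≡⟨ sumℤ-allWords-subst flip alphabet flip-permutes L containing ⟩
    sumℤ (containing ∘ map flip) (allWords alphabet L)
      ≡⟨ sumℤ-allWords-congᴬ alphabet-above L (λ w w≥u _ → flip-reverses P x w x≥u x≢u w≥u) ⟩
    sumℤ (λ w → - containing w) (allWords alphabet L)
      ≡⟨ sumℤ-neg containing (allWords alphabet L) ⟩
    - sumℤ containing (allWords alphabet L) ∎)
    where
    containing : List ℤ → ℤ
    containing w = when (not (absFresh (+ suc u) w)) (weight P (x ∷ w))

  split : ∀ b a → a ≡ when b a + when (not b) a
  split true  a = sym (ℤP.+-identityʳ a)
  split false a = sym (ℤP.+-identityˡ a)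

  larger-head : ∀ P L x → AbsAtLeast (suc u) x → (suc u ≡ᵇ ∣ x ∣) ≡ false →
    sumℤ (λ w → weight P (x ∷ w)) (allWords alphabet L) ≡ sumℤ (λ w → weight P (x ∷ w)) (allWords (signedAlphabet U') L)
  larger-head P L x x≥u x≢u = begin
    sumℤ (λ w → weight P (x ∷ w)) (allWords alphabet L)
      ≡⟨ sumℤ-cong (allWords alphabet L) (λ w → split (absFresh (+ suc u) w) (weight P (x ∷ w))) ⟩
    sumℤ (λ w → when (absFresh (+ suc u) w) (weight P (x ∷ w)) + when (not (absFresh (+ suc u) w)) (weight P (x ∷ w)))
         (allWords alphabet L)
      ≡⟨ sumℤ-+ _ _ (allWords alphabet L) ⟩
    _ ≡⟨ cong₂ _+_ (avoiding L (λ w → weight P (x ∷ w))) (containing-cancel P L x x≥u x≢u) ⟩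
    _ ≡⟨ ℤP.+-identityʳ _ ⟩
    sumℤ (λ w → weight P (x ∷ w)) (allWords (signedAlphabet U') L) ∎

  -- W(u ∷ U', L+1, P) = W(U', L, P) - W(U', L, P ∘ suc) + W(U', L+1, P),
  -- according to the first letter being u+1, -(u+1), or of larger absolute value
  signedSum-rec : ∀ L P →
    signedSum (u ∷ U') (suc L) P ≡ (signedSum U' L P + - signedSum U' L (P ∘ suc)) + signedSum U' (suc L) P
  signedSum-rec L P = begin
    signedSum (u ∷ U') (suc L) P
      ≡⟨ sumℤ-allWords-suc (weight P) alphabet L ⟩
    headed (+ suc u) + (headed -[1+ u ] + sumℤ headed (signedAlphabet U'))
      ≡⟨ cong₂ _+_ pos-head (cong₂ _+_ neg-head other-heads) ⟩
    signedSum U' L P + (- signedSum U' L (P ∘ suc) + signedSum U' (suc L) P)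
      ≡⟨ ℤP.+-assoc (signedSum U' L P) _ _ ⟨
    (signedSum U' L P + - signedSum U' L (P ∘ suc)) + signedSum U' (suc L) P ∎
    where
    headed : ℤ → ℤ
    headed x = sumℤ (λ w → weight P (x ∷ w)) (allWords alphabet L)
    pos-head : headed (+ suc u) ≡ signedSum U' L P
    pos-head = trans (sumℤ-allWords-congᴬ alphabet-above L (λ w w≥u _ → weight-∷-pos P u w w≥u))
                     (avoiding L (weight P))
    neg-head : headed -[1+ u ] ≡ - signedSum U' L (P ∘ suc)
    neg-head = trans (sumℤ-allWords-congᴬ alphabet-above L (λ w w≥u _ → weight-∷-neg P u w w≥u))
                     (trans (avoiding L (λ w → - weight (P ∘ suc) w))
                            (sumℤ-neg (weight (P ∘ suc)) (allWords (signedAlphabet U') L)))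
    other-heads : sumℤ headed (signedAlphabet U') ≡ signedSum U' (suc L) P
    other-heads = trans (sumℤ-congᴬ larger (λ x (x≥u , x≢u) → larger-head P L x x≥u x≢u))
                        (sym (sumℤ-allWords-suc (weight P) (signedAlphabet U') L))

-- Solving the recursion: W(U, L, P) only depends on |U|

signedSumRec : ℕ → ℕ → (ℕ → Bool) → ℤ
signedSumRec n       zero    P = when (P 0) 1ℤ
signedSumRec zero    (suc L) P = 0ℤ
signedSumRec (suc n) (suc L) P =
  (signedSumRec n L P + - signedSumRec n L (P ∘ suc)) + signedSumRec n (suc L) P

signedSum≡Rec : ∀ U → AllPairs _<_ U → ∀ L P → signedSum U L P ≡ signedSumRec (length U) L P
signedSum≡Rec U        _               zero    P = ℤP.+-identityʳ _
signedSum≡Rec []       _               (suc L) P = refl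
signedSum≡Rec (u ∷ U') (u<U' ∷ U'-inc) (suc L) P =
  trans (FirstLetter.signedSum-rec u U' u<U' L P)
        (cong₂ _+_ (cong₂ (λ a b → a + - b) (signedSum≡Rec U' U'-inc L P) (signedSum≡Rec U' U'-inc L (P ∘ suc)))
                   (signedSum≡Rec U' U'-inc (suc L) P))

signedSumRec-cong : ∀ n L {P P'} → (∀ d → P d ≡ P' d) → signedSumRec n L P ≡ signedSumRec n L P'
signedSumRec-cong n       zero    P≡P' rewrite P≡P' 0 = refl
signedSumRec-cong zero    (suc L) P≡P' = refl
signedSumRec-cong (suc n) (suc L) P≡P' =
  cong₂ _+_ (cong₂ (λ a b → a + - b) (signedSumRec-cong n L P≡P') (signedSumRec-cong n L (P≡P' ∘ suc)))
            (signedSumRec-cong n (suc L) P≡P')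

signedSumRec-never : ∀ n L {P} → (∀ d → P d ≡ false) → signedSumRec n L P ≡ 0ℤ
signedSumRec-never n       zero    never rewrite never 0 = refl
signedSumRec-never zero    (suc L) never = refl
signedSumRec-never (suc n) (suc L) never
  rewrite signedSumRec-never n L never | signedSumRec-never n L (never ∘ suc)
        | signedSumRec-never n (suc L) never = refl

-- there are no words with distinct absolute values longer than the alphabet
signedSumRec-long : ∀ n L P → n < L → signedSumRec n L P ≡ 0ℤ
signedSumRec-long zero    (suc L) P _         = refl
signedSumRec-long (suc n) (suc L) P (s≤s n<L)
  rewrite signedSumRec-long n L P n<L | signedSumRec-long n L (P ∘ suc) n<L
        | signedSumRec-long n (suc L) P (ℕP.m≤n⇒m≤1+n n<L) = refl

signed-pascal : ∀ a x y → ((-1ℤ * a) * y + - (a * x)) + 0ℤ ≡ (-1ℤ * a) * (x + y)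
signed-pascal = solve 3 (λ a x y → ((con -1ℤ :* a) :* y :+ :- (a :* x)) :+ con 0ℤ := (con -1ℤ :* a) :* (x :+ y)) refl
  where open +-*-Solver

signedSumRec-diag : ∀ n k → signedSumRec n n (_≡ᵇ k) ≡ (-1ℤ ^ k) * + (n C k)
signedSumRec-diag zero    zero    = refl
signedSumRec-diag zero    (suc k) = sym (ℤP.*-zeroʳ (-1ℤ ^ suc k))
signedSumRec-diag (suc n) zero
  rewrite signedSumRec-diag n 0 | signedSumRec-never n n {λ d → suc d ≡ᵇ 0} (λ d → refl)
        | signedSumRec-long n (suc n) (_≡ᵇ 0) (ℕP.n<1+n n) = refl
signedSumRec-diag (suc n) (suc k) = begin
  (signedSumRec n n (_≡ᵇ suc k) + - signedSumRec n n (λ d → suc d ≡ᵇ suc k)) + signedSumRec n (suc n) (_≡ᵇ suc k)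
    ≡⟨ cong₂ (λ a b → (signedSumRec n n (_≡ᵇ suc k) + - a) + b)
             (signedSumRec-cong n n {λ d → suc d ≡ᵇ suc k} {_≡ᵇ k} (λ d → refl))
             (signedSumRec-long n (suc n) _ (ℕP.n<1+n n)) ⟩
  (signedSumRec n n (_≡ᵇ suc k) + - signedSumRec n n (_≡ᵇ k)) + 0ℤ
    ≡⟨ cong₂ (λ a b → (a + - b) + 0ℤ) (signedSumRec-diag n (suc k)) (signedSumRec-diag n k) ⟩
  ((-1ℤ * (-1ℤ ^ k)) * + (n C suc k) + - ((-1ℤ ^ k) * + (n C k))) + 0ℤ
    ≡⟨ signed-pascal (-1ℤ ^ k) (+ (n C k)) (+ (n C suc k)) ⟩
  (-1ℤ * (-1ℤ ^ k)) * (+ (n C k) + + (n C suc k))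
    ≡⟨ cong ((-1ℤ * (-1ℤ ^ k)) *_) (trans (sym (ℤP.pos-+ (n C k) (n C suc k))) (cong +_ (nCk+nC[k+1]≡[n+1]C[k+1] n k))) ⟩
  (-1ℤ ^ suc k) * + (suc n C suc k) ∎

signedDescentSum : ∀ n k → signedSum (upTo n) n (_≡ᵇ k) ≡ (-1ℤ ^ k) * + (n C k)
signedDescentSum n k = begin
  signedSum (upTo n) n (_≡ᵇ k)
    ≡⟨ signedSum≡Rec (upTo n) (AllPairsP.applyUpTo⁺₁ id n (λ i<j _ → i<j)) n (_≡ᵇ k) ⟩
  signedSumRec (length (upTo n)) n (_≡ᵇ k)
    ≡⟨ cong (λ m → signedSumRec m n (_≡ᵇ k)) (length-upTo n) ⟩
  signedSumRec n n (_≡ᵇ k)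
    ≡⟨ signedSumRec-diag n k ⟩
  (-1ℤ ^ k) * + (n C k) ∎

-- Even minus odd signed permutations

-- the number of signed permutations of [n] with j descents whose parity of
-- negative entries passes the test pe (id: even ones, not: odd ones)
parityCount : ℕ → (Bool → Bool) → ℕ → ℤ
parityCount n pe j =
  sumℤ (λ w → when (distinctAbs w) (when (pe (isEven (negCount w))) (when (des w ≡ᵇ j) 1ℤ)))
       (allWords (signedValues n) n)

D≡parityCount : ∀ n j → + D n j ≡ parityCount n id j
D≡parityCount n j =
  trans (length-filterᵇ (λ w → des w ≡ᵇ j) (evenSignedPerms n))
  (trans (sumℤ-filterᵇ (λ w → when (des w ≡ᵇ j) 1ℤ) (λ w → isEven (negCount w)) (signedPerms n))
         (sumℤ-filterᵇ (λ w → when (isEven (negCount w)) (when (des w ≡ᵇ j) 1ℤ)) distinctAbs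
                       (allWords (signedValues n) n)))

isEven-suc : ∀ m → isEven (suc m) ≡ not (isEven m)
isEven-suc zero    = refl
isEven-suc (suc m) rewrite isEven-suc m = sym (BP.not-involutive (isEven m))

sign≡parity : ∀ w → sign w ≡ (if isEven (negCount w) then 1ℤ else -1ℤ)
sign≡parity []       = refl
sign≡parity (x ∷ xs) with x ℤ.≤ᵇ -1ℤ
... | true rewrite sign≡parity xs | isEven-suc (negCount xs) with isEven (negCount xs)
...   | true  = refl
...   | false = refl
sign≡parity (x ∷ xs) | false rewrite sign≡parity xs with isEven (negCount xs)
...   | true  = refl
...   | false = refl

even-odd≡signedSum : ∀ n k → parityCount n id k + - parityCount n not k ≡ signedSum (upTo n) n (_≡ᵇ k)
even-odd≡signedSum n k =
  trans (cong (λ s → parityCount n id k + s) (sym (sumℤ-neg _ (allWords (signedValues n) n))))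
  (trans (sym (sumℤ-+ _ _ (allWords (signedValues n) n))) (sumℤ-cong (allWords (signedValues n) n) pointwise))
  where
  pointwise : ∀ w → when (distinctAbs w) (when (isEven (negCount w)) (when (des w ≡ᵇ k) 1ℤ))
                    + - when (distinctAbs w) (when (not (isEven (negCount w))) (when (des w ≡ᵇ k) 1ℤ))
                    ≡ weight (_≡ᵇ k) w
  pointwise w rewrite sign≡parity w with distinctAbs w | isEven (negCount w) | des w ≡ᵇ k
  ... | false | _     | _     = refl
  ... | true  | true  | true  = refl
  ... | true  | true  | false = refl
  ... | true  | false | true  = refl
  ... | true  | false | false = refl

oddCount : ∀ n k → parityCount n not k ≡ + D n k + - ((-1ℤ ^ k) * + (n C k))
oddCount n k = begin
  odd                     ≡⟨ solve 2 (λ X Y → Y := X :+ :- (X :+ :- Y)) refl even odd ⟩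
  even + - (even + - odd) ≡⟨ cong₂ (λ a b → a + - b) (sym (D≡parityCount n k))
                                   (trans (even-odd≡signedSum n k) (signedDescentSum n k)) ⟩
  + D n k + - ((-1ℤ ^ k) * + (n C k)) ∎
  where
  open +-*-Solver
  even odd : ℤ
  even = parityCount n id k
  odd  = parityCount n not k

-- Negation symmetry

neg-permutes : ∀ U (g : ℤ → ℤ) → sumℤ g (signedAlphabet U) ≡ sumℤ (g ∘ -_) (signedAlphabet U)
neg-permutes []      g = refl
neg-permutes (u ∷ U) g =
  trans (+-CS.x∙yz≈y∙xz (g (+ suc u)) (g -[1+ u ]) _)
        (cong (λ s → g -[1+ u ] + (g (+ suc u) + s)) (neg-permutes U g))

signedValues-nonzero : ∀ n → All (AbsAtLeast 1) (signedValues n)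
signedValues-nonzero n = All-signedAlphabet (AllP.applyUpTo⁺₂ id n (λ i → s≤s z≤n , s≤s z≤n))

negCount-neg : ∀ w → All (AbsAtLeast 1) w → negCount (map -_ w) ℕ.+ negCount w ≡ length w
negCount-neg []              _        = refl
negCount-neg (+ suc k  ∷ ys) (_ ∷ ps) = cong suc (negCount-neg ys ps)
negCount-neg (-[1+ k ] ∷ ys) (_ ∷ ps) =
  trans (ℕP.+-suc (negCount (map -_ ys)) (negCount ys)) (cong suc (negCount-neg ys ps))

absFresh-zero : ∀ w → All (AbsAtLeast 1) w → absFresh +0 w ≡ true
absFresh-zero []              _        = refl
absFresh-zero (+ suc k  ∷ ys) (_ ∷ ps) = absFresh-zero ys ps
absFresh-zero (-[1+ k ] ∷ ys) (_ ∷ ps) = absFresh-zero ys ps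

neg-≤ᵇ : ∀ p y → (- p ℤ.≤ᵇ - y) ≡ (y ℤ.≤ᵇ p)
neg-≤ᵇ p y with - p ℤ.≤ᵇ - y in e₁ | y ℤ.≤ᵇ p in e₂
... | true  | true  = refl
... | false | false = refl
... | true  | false with () ← trans (sym (T⇒true (ℤP.≤⇒≤ᵇ (ℤP.neg-cancel-≤ {p} {y} (ℤP.≤ᵇ⇒≤ (true⇒T e₁)))))) e₂
... | false | true  with () ← trans (sym (T⇒true (ℤP.≤⇒≤ᵇ (ℤP.neg-mono-≤ {y} {p} (ℤP.≤ᵇ⇒≤ (true⇒T e₂)))))) e₁

descent-one-way : ∀ p y → (p ≡ y → ⊥) → (if y ℤ.≤ᵇ p then 0 else 1) ℕ.+ (if p ℤ.≤ᵇ y then 0 else 1) ≡ 1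
descent-one-way p y p≢y with y ℤ.≤ᵇ p in e₁ | p ℤ.≤ᵇ y in e₂
... | true  | false = refl
... | false | true  = refl
... | true  | true  = ⊥-elim (p≢y (ℤP.≤-antisym (ℤP.≤ᵇ⇒≤ (true⇒T e₂)) (ℤP.≤ᵇ⇒≤ (true⇒T e₁))))
... | false | false with ℤP.≤-total p y
...   | inj₁ p≤y with () ← trans (sym (T⇒true (ℤP.≤⇒≤ᵇ p≤y))) e₂
...   | inj₂ y≤p with () ← trans (sym (T⇒true (ℤP.≤⇒≤ᵇ y≤p))) e₁

desAux-neg : ∀ p ws → distinctAbs (p ∷ ws) ≡ true → desAux (- p) (map -_ ws) ℕ.+ desAux p ws ≡ length ws
desAux-neg p []       _ = refl
desAux-neg p (y ∷ ys) d rewrite neg-≤ᵇ p y = begin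
  (a ℕ.+ desAux (- y) (map -_ ys)) ℕ.+ (b ℕ.+ desAux y ys)
    ≡⟨ ℕ+-CS.interchange a _ b _ ⟩
  (a ℕ.+ b) ℕ.+ (desAux (- y) (map -_ ys) ℕ.+ desAux y ys)
    ≡⟨ cong₂ ℕ._+_ (descent-one-way p y p≢y) (desAux-neg y ys (distinct-tail p (y ∷ ys) d)) ⟩
  suc (length ys) ∎
  where
  a b : ℕ
  a = if y ℤ.≤ᵇ p then 0 else 1
  b = if p ℤ.≤ᵇ y then 0 else 1
  p≢y : p ≡ y → ⊥
  p≢y p≡y = ≡ᵇ-false⇒≢ {∣ p ∣} (fresh-head p y ys (distinct-head p (y ∷ ys) d)) (cong ∣_∣ p≡y)

T-ext : ∀ {x y} → (T x → T y) → (T y → T x) → x ≡ y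
T-ext {true}  {true}  _ _ = refl
T-ext {false} {false} _ _ = refl
T-ext {true}  {false} f _ = ⊥-elim (f tt)
T-ext {false} {true}  _ g = ⊥-elim (g tt)

≡ᵇ-complement : ∀ a b n j → a ℕ.+ b ≡ n → j ≤ n → (a ≡ᵇ j) ≡ (b ≡ᵇ n ∸ j)
≡ᵇ-complement a b n j a+b≡n j≤n = T-ext to from
  where
  to : T (a ≡ᵇ j) → T (b ≡ᵇ n ∸ j)
  to t = ℕP.≡⇒≡ᵇ b (n ∸ j) (trans (sym (ℕP.m+n∸m≡n a b)) (cong₂ _∸_ a+b≡n (ℕP.≡ᵇ⇒≡ a j t)))
  from : T (b ≡ᵇ n ∸ j) → T (a ≡ᵇ j)
  from t = ℕP.≡⇒≡ᵇ a j (trans (sym (ℕP.m+n∸n≡m a b))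
                              (trans (cong₂ _∸_ a+b≡n (ℕP.≡ᵇ⇒≡ b (n ∸ j) t)) (ℕP.m∸[m∸n]≡n j≤n)))

negation-symmetry : ∀ n (fl : Bool → Bool) → (∀ a b → a ℕ.+ b ≡ n → isEven a ≡ fl (isEven b)) →
  ∀ pe j → j ≤ n → parityCount n pe j ≡ parityCount n (pe ∘ fl) (n ∸ j)
negation-symmetry n fl parity-rule pe j j≤n =
  trans (sumℤ-allWords-subst -_ (signedValues n) (neg-permutes (upTo n)) n _)
        (sumℤ-allWords-congᴬ (signedValues-nonzero n) n pointwise)
  where
  open AbsPreserving -_ ℤP.∣-i∣≡∣i∣
  pointwise : ∀ w → All (AbsAtLeast 1) w → length w ≡ n →
    when (distinctAbs (map -_ w)) (when (pe (isEven (negCount (map -_ w)))) (when (des (map -_ w) ≡ᵇ j) 1ℤ))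
      ≡ when (distinctAbs w) (when (pe (fl (isEven (negCount w)))) (when (des w ≡ᵇ n ∸ j) 1ℤ))
  pointwise w w≠0 lw rewrite distinctAbs-map w with distinctAbs w in d
  ... | false = refl
  ... | true
    rewrite parity-rule (negCount (map -_ w)) (negCount w) (trans (negCount-neg w w≠0) lw)
          | ≡ᵇ-complement (des (map -_ w)) (des w) n j
              (trans (desAux-neg +0 w (trans (cong (_∧ distinctAbs w) (absFresh-zero w w≠0)) d)) lw) j≤n
          = refl

isEven-+ : ∀ a b → isEven a ≡ (if isEven (a ℕ.+ b) then isEven b else not (isEven b))
isEven-+ zero    b with isEven b
... | true  = refl
... | false = refl
isEven-+ (suc a) b rewrite isEven-suc a | isEven-suc (a ℕ.+ b) | isEven-+ a b
  with isEven (a ℕ.+ b) | isEven b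
... | true  | true  = refl
... | true  | false = refl
... | false | true  = refl
... | false | false = refl

isEven-+-even : ∀ {n} → isEven n ≡ true → ∀ a b → a ℕ.+ b ≡ n → isEven a ≡ isEven b
isEven-+-even n-even a b a+b≡n =
  trans (isEven-+ a b) (cong (λ z → if z then isEven b else not (isEven b)) (trans (cong isEven a+b≡n) n-even))

isEven-+-odd : ∀ {n} → isEven n ≡ false → ∀ a b → a ℕ.+ b ≡ n → isEven a ≡ not (isEven b)
isEven-+-odd n-odd a b a+b≡n =
  trans (isEven-+ a b) (cong (λ z → if z then isEven b else not (isEven b)) (trans (cong isEven a+b≡n) n-odd))

-1^≡parity : ∀ m → -1ℤ ^ m ≡ (if isEven m then 1ℤ else -1ℤ)
-1^≡parity zero    = refl
-1^≡parity (suc m) rewrite -1^≡parity m | isEven-suc m with isEven m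
... | true  = refl
... | false = refl

isEven⇒2∣ : ∀ n → isEven n ≡ true → 2 ∣ n
isEven⇒2∣ zero          _ = 2 ∣0
isEven⇒2∣ (suc (suc m)) e = ∣m∣n⇒∣m+n (∣-refl {2}) (isEven⇒2∣ m e)

2∣⇒isEven : ∀ {n} → 2 ∣ n → isEven n ≡ true
2∣⇒isEven (divides q refl) = even-double q
  where
  even-double : ∀ q → isEven (q ℕ.* 2) ≡ true
  even-double zero    = refl
  even-double (suc q) = even-double q

2∤⇒isEven-false : ∀ n → ¬ (2 ∣ n) → isEven n ≡ false
2∤⇒isEven-false n 2∤n with isEven n in e
... | false = refl
... | true  = ⊥-elim (2∤n (isEven⇒2∣ n e))

-1^-opposite : ∀ m j c → isEven m ≡ not (isEven j) → - ((-1ℤ ^ m) * c) ≡ (-1ℤ ^ j) * c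
-1^-opposite m j c m≢j rewrite -1^≡parity m | -1^≡parity j | m≢j with isEven j
... | true  = trans (cong -_ (ℤP.-1*i≡-i c)) (trans (ℤP.neg-involutive c) (sym (ℤP.*-identityˡ c)))
... | false = trans (cong -_ (ℤP.*-identityˡ c)) (sym (ℤP.-1*i≡-i c))

corollary3p15 : (n : ℕ) → 1 ≤ n →
    ((2 ∣ n) → (j : ℕ) → j ≤ n → D n j ≡ D n (n ∸ j))
    × ((¬ (2 ∣ n)) → (j : ℕ) → j ≤ n →
        + D n j ≡ + D n (n ∸ j) + (-1ℤ ^ j) * + (n C j))
corollary3p15 n _ = even-case , odd-case
  where
  even-case : 2 ∣ n → (j : ℕ) → j ≤ n → D n j ≡ D n (n ∸ j)
  even-case 2∣n j j≤n = ℤP.+-injective (begin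
    + D n j                   ≡⟨ D≡parityCount n j ⟩
    parityCount n id j        ≡⟨ negation-symmetry n id (isEven-+-even (2∣⇒isEven 2∣n)) id j j≤n ⟩
    parityCount n id (n ∸ j)  ≡⟨ D≡parityCount n (n ∸ j) ⟨
    + D n (n ∸ j)             ∎)

  odd-case : ¬ (2 ∣ n) → (j : ℕ) → j ≤ n → + D n j ≡ + D n (n ∸ j) + (-1ℤ ^ j) * + (n C j)
  odd-case 2∤n j j≤n = begin
    + D n j                                   ≡⟨ D≡parityCount n j ⟩
    parityCount n id j                        ≡⟨ negation-symmetry n not n-odd id j j≤n ⟩
    parityCount n not m                       ≡⟨ oddCount n m ⟩
    + D n m + - ((-1ℤ ^ m) * + (n C m))       ≡⟨ cong (λ c → + D n m + - ((-1ℤ ^ m) * + c)) (nCk≡nC[n∸k] j≤n) ⟨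
    + D n m + - ((-1ℤ ^ m) * + (n C j))       ≡⟨ cong (λ s → + D n m + s) (-1^-opposite m j _ (n-odd m j (ℕP.m∸n+n≡m j≤n))) ⟩
    + D n m + (-1ℤ ^ j) * + (n C j)           ∎
    where
    m : ℕ
    m = n ∸ j
    n-odd : ∀ a b → a ℕ.+ b ≡ n → isEven a ≡ not (isEven b)
    n-odd = isEven-+-odd (2∤⇒isEven-false n 2∤n)
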